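{- Every obstruction $G$ for the class $\mathcal C$ of all graphs of linear rankwidth at most $1$ is connected.
   Context: Graphs are finite, simple, undirected; a connected graph is nonempty. For $X\subseteq V(G)$, $\operatorname{cutrk}_G(X)$ is the $\mathrm{GF}(2)$-rank of the submatrix of the adjacency matrix with rows $X$ and columns $V(G)\setminus X$. A linear rank decomposition of $G$ ($|V(G)|\ge2$) is a pair $(T,\lambda)$ with $T$ a caterpillar with at least two vertices whose non-leaf vertices have degree $3$ and $\lambda$ a bijection from leaves of $T$ to $V(G)$; an edge $e$ of $T$ splitting the leaves into $(X_e,Y_e)$ has width $\operatorname{cutrk}_G(\lambda(X_e))$; linear rankwidth is the minimum over decompositions of the maximum edge width ($0$ if $|V(G)|\le1$). The local complementation $G*v$ has vertex set $V(G)$ and edge set $E(G)$ symmetric-differenced with all pairs of distinct vertices of $N_G(v)$; $G$ and $H$ are locally equivalent if $H$ arises from $G$ by a sequence of local complementations. A graph $G$ is an obstruction for $\mathcal C$ if every $H$ locally equivalent to $G$ satisfies $H\notin\mathcal C$ and $H\setminus v\in\mathcal C$ for every $v\in V(H)$. -}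

module Defs where

open import Data.Nat using (ℕ; zero; suc; _≤_; _<_; _+_; pred)
open import Data.Fin using (Fin; zero; suc; toℕ; punchIn; _≟_)
open import Data.Fin.Permutation using (Permutation′; _⟨$⟩ʳ_; _⟨$⟩ˡ_)
open import Data.Bool using (Bool; true; false; _∧_; _xor_; not)
open import Data.Bool.Properties using (∧-comm)
open import Data.Product using (Σ; ∃; _×_; _,_)
open import Data.Sum using (_⊎_)
open import Relation.Nullary using (¬_; does)
open import Relation.Nullary.Decidable using (dec-true)
open import Relation.Binary.PropositionalEquality using (_≡_; refl; cong; cong₂; sym; trans)

record Graph (n : ℕ) : Set where
  field
    adj    : Fin n → Fin n → Bool
    adj-sym    : ∀ x y → adj x y ≡ adj y x
    adj-irrefl : ∀ x → adj x x ≡ false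
open Graph public

VSet : ℕ → Set
VSet n = Fin n → Bool

xorSum : ∀ {m} → (Fin m → Bool) → Bool
xorSum {zero}  f = false
xorSum {suc m} f = f zero xor xorSum (λ i → f (suc i))

-- The rows r 0, …, r (m-1) (elements of X) of the cut matrix
-- A[X, V∖X] are linearly independent over GF(2): every nonempty
-- GF(2)-combination of them is a nonzero vector (on the columns V∖X).
RowsIndependent : ∀ {n m} → Graph n → VSet n → (Fin m → Fin n) → Set
RowsIndependent {n} {m} G X r =
  (c : Fin m → Bool) → (∃ λ i → c i ≡ true) →
  ∃ λ (y : Fin n) → (X y ≡ false) × (xorSum (λ i → c i ∧ adj G (r i) y) ≡ true)

-- cutrk_G(X) ≤ k : the GF(2)-rank of A[X, V∖X] (maximum number of
-- linearly independent rows) is at most k, i.e. no k+1 rows are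
-- linearly independent.
CutRkAtMost : ∀ {n} → Graph n → VSet n → ℕ → Set
CutRkAtMost {n} G X k =
  (r : Fin (suc k) → Fin n) → (∀ i → X (r i) ≡ true) → ¬ RowsIndependent G X r

-- A caterpillar with n ≥ 2 leaves whose non-leaf vertices have degree 3
-- is determined (up to isomorphism) by an ordering of its leaves
-- ℓ₀, …, ℓₙ₋₁: spine vertices s₀,…,sₙ₋₃, s₀ carries ℓ₀,ℓ₁, sⱼ carries
-- ℓⱼ₊₁ and sₙ₋₃ carries ℓₙ₋₂,ℓₙ₋₁ (for n = 2 the tree is a single edge).
-- Its edges are: the leaf edges (one per leaf ℓ, splitting off {ℓ}) and
-- the spine edges sⱼ sⱼ₊₁ for 0 ≤ j, j + 4 ≤ n, splitting off {ℓ₀,…,ℓⱼ₊₁}.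
-- λ is a bijection leaves → V(G), given by a permutation of Fin n.

singletonSet : ∀ {n} → Fin n → VSet n
singletonSet v w = does (v ≟ w)

-- λ({ℓ₀,…,ℓⱼ₊₁}) as a vertex set
prefixSet : ∀ {n} → Permutation′ n → ℕ → VSet n
prefixSet π j v = does (toℕ (π ⟨$⟩ˡ v) Data.Nat.≤? suc j)
  where import Data.Nat

DecompWidthAtMost : ∀ {n} → Graph n → Permutation′ n → ℕ → Set
DecompWidthAtMost {n} G π k =
  (∀ (ℓ : Fin n) → CutRkAtMost G (singletonSet (π ⟨$⟩ʳ ℓ)) k) ×
  (∀ (j : ℕ) → j + 4 ≤ n → CutRkAtMost G (prefixSet π j) k)

-- linear rankwidth ≤ k  (rankwidth is 0 when |V| ≤ 1)
LinRankWidthAtMost : ∀ {n} → Graph n → ℕ → Set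
LinRankWidthAtMost {n} G k =
  (n ≤ 1) ⊎ ((2 ≤ n) × Σ (Permutation′ n) λ π → DecompWidthAtMost G π k)

LRW≤1 : ∀ {n} → Graph n → Set
LRW≤1 G = LinRankWidthAtMost G 1

neq : ∀ {n} → Fin n → Fin n → Bool
neq x y = not (does (x ≟ y))

neq-sym : ∀ {n} (x y : Fin n) → neq x y ≡ neq y x
neq-sym x y with x ≟ y | y ≟ x
... | Relation.Nullary.yes _ | Relation.Nullary.yes _ = refl
... | Relation.Nullary.no _  | Relation.Nullary.no _  = refl
... | Relation.Nullary.yes p | Relation.Nullary.no q  = Data.Empty.⊥-elim (q (sym p))
  where import Data.Empty
... | Relation.Nullary.no p  | Relation.Nullary.yes q = Data.Empty.⊥-elim (p (sym q))
  where import Data.Empty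

neq-refl : ∀ {n} (x : Fin n) → neq x x ≡ false
neq-refl x rewrite dec-true (x ≟ x) refl = refl

localComp : ∀ {n} → Graph n → Fin n → Graph n
localComp G v = record
  { adj        = λ x y → adj G x y xor (neq x y ∧ (adj G v x ∧ adj G v y))
  ; adj-sym    = λ x y → cong₂ _xor_ (Graph.adj-sym G x y)
               (cong₂ _∧_ (neq-sym x y) (∧-comm (adj G v x) (adj G v y)))
  ; adj-irrefl = λ x → trans (cong₂ _xor_ (Graph.adj-irrefl G x)
               (cong (_∧ (adj G v x ∧ adj G v x)) (neq-refl x))) refl
  }

data LocEquiv {n} (G : Graph n) : Graph n → Set where
  here : LocEquiv G G
  step : ∀ {H} → LocEquiv G H → (v : Fin n) → LocEquiv G (localComp H v)

delete : ∀ {n} → Graph n → Fin n → Graph (pred n)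
delete {suc m} G v = record
  { adj        = λ x y → adj G (punchIn v x) (punchIn v y)
  ; adj-sym    = λ x y → Graph.adj-sym G (punchIn v x) (punchIn v y)
  ; adj-irrefl = λ x → Graph.adj-irrefl G (punchIn v x)
  }

GraphClass : Set₁
GraphClass = ∀ {n} → Graph n → Set

Obstruction : GraphClass → ∀ {n} → Graph n → Set
Obstruction 𝒞 {n} G =
  ∀ (H : Graph n) → LocEquiv G H → (¬ 𝒞 H) × (∀ (v : Fin n) → 𝒞 (delete H v))

data Reachable {n} (G : Graph n) : Fin n → Fin n → Set where
  here : ∀ {u} → Reachable G u u
  step : ∀ {u w v} → adj G u w ≡ true → Reachable G w v → Reachable G u v

Connected : ∀ {n} → Graph n → Set
Connected {n} G = (0 < n) × (∀ (u v : Fin n) → Reachable G u v)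

-- Suppose G is an obstruction with two vertices u, v in different
-- components, and let S be the component of u.  The
-- graphs G − v and G − u have linear rankwidth at most 1; order S as in a
-- good layout of G − v and the rest as in a good layout of G − u, and put
-- the S-part first.  An initial segment of this order either lies inside S
-- or contains all of S, and since no edge leaves S its cut in G is a cut
-- of G − v resp. G − u.  So G itself has linear rankwidth at most 1, which
-- contradicts G being an obstruction.
module Submission where

open import Data.Bool using (Bool; true; false; _∧_; _∨_; _xor_; not; if_then_else_)
import Data.Bool.Properties as Boolₚ
open import Data.Empty using (⊥-elim)
open import Data.Fin as Fin using (Fin; zero; suc; toℕ; fromℕ<; punchIn; punchOut)
open import Data.Fin.Properties
  using (toℕ-injective; toℕ<n; toℕ-fromℕ<; punchOut-injective; punchIn-punchOut; injective⇒≤; any?)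
open import Data.Fin.Permutation using (Permutation′; _⟨$⟩ʳ_; _⟨$⟩ˡ_; permutation; inverseˡ; inverseʳ)
open import Data.Fin.Subset using (_∈_; _⊆_; ∣_∣)
open import Data.Fin.Subset.Properties using (∈⊤; ∉⊥; ∣p∣≤n; ∣⊤∣≡n; ∣⊥∣≡0; p⊆q⇒∣p∣≤∣q∣; p⊂q⇒∣p∣<∣q∣)
open import Data.Nat using (ℕ; zero; suc; _≤_; _<_; _+_; _∸_; z≤n; s≤s; s≤s⁻¹; _≤?_; _<?_)
open import Data.Nat.Properties
  using (≤-refl; <⇒≤; <-trans; <-cmp; n≤1+n; +-comm; ≤-trans; <-≤-trans; ≤-<-trans; <-irrefl; ≮⇒≥; ≰⇒>; n<1⇒n≡0; m≤m+n; +-cancelˡ-≡; ≤-antisym; 1+n≰n)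
open import Data.Product using (Σ; ∃; _×_; _,_; proj₁; proj₂)
open import Data.Sum using (_⊎_; inj₁; inj₂)
open import Data.Vec using (tabulate)
open import Data.Vec.Properties using (lookup⇒[]=; []=⇒lookup; lookup∘tabulate)
open import Function using (_∘_; mk⇔)
open import Function.Definitions using (Injective)
open import Relation.Binary.PropositionalEquality
  using (_≡_; _≢_; _≗_; refl; cong; cong₂; sym; trans; subst)
open import Relation.Binary.Definitions using (tri<; tri≈; tri>)
open import Relation.Nullary using (¬_; Dec; does; yes; no; _×-dec_)
open import Relation.Nullary.Decidable using (dec-true; dec-false; does-⇔)

open import Defs

private
  variable
    n : ℕ

true≢false : true ≢ false
true≢false ()

xor-cancel : ∀ {a b} → a ≡ b → a xor (b xor false) ≡ false
xor-cancel {a} refl = trans (cong (a xor_) (Boolₚ.xor-identityʳ a)) (Boolₚ.xor-same a)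

dec-true⁻¹ : ∀ {p} {P : Set p} (p? : Dec P) → does p? ≡ true → P
dec-true⁻¹ (yes p) _ = p
dec-true⁻¹ (no _) ()

dec-false⁻¹ : ∀ {p} {P : Set p} (p? : Dec P) → does p? ≡ false → ¬ P
dec-false⁻¹ (no ¬p) _ = ¬p
dec-false⁻¹ (yes _) ()

_⊆ᵛ_ : VSet n → VSet n → Set
X ⊆ᵛ Y = ∀ x → X x ≡ true → Y x ≡ true

Subsingleton : VSet n → Set
Subsingleton X = ∀ x y → X x ≡ true → X y ≡ true → x ≡ y

Subsingleton-≤1 : n ≤ 1 → (X : VSet n) → Subsingleton X
Subsingleton-≤1 {suc zero} _ X zero zero _ _ = refl
Subsingleton-≤1 {suc (suc _)} (s≤s ()) X

below : (Fin n → ℕ) → ℕ → VSet n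
below K t x = does (K x <? t)

+-<?-∸ : ∀ m p t → does (m + p <? t) ≡ does (p <? t ∸ m)
+-<?-∸ zero    p t       = refl
+-<?-∸ (suc m) p zero    = refl
+-<?-∸ (suc m) p (suc t) = +-<?-∸ m p t

size : VSet n → ℕ
size X = ∣ tabulate X ∣

module _ (X : VSet n) {x : Fin n} where

  ∈-tabulate⁺ : X x ≡ true → x ∈ tabulate X
  ∈-tabulate⁺ Xx = lookup⇒[]= x (tabulate X) (trans (lookup∘tabulate X x) Xx)

  ∈-tabulate⁻ : x ∈ tabulate X → X x ≡ true
  ∈-tabulate⁻ x∈X = trans (sym (lookup∘tabulate X x)) ([]=⇒lookup x∈X)

  ∉-tabulate⁺ : X x ≡ false → ¬ (x ∈ tabulate X)
  ∉-tabulate⁺ Xx x∈X = true≢false (trans (sym (∈-tabulate⁻ x∈X)) Xx)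

tabulate-⊆ : (X Y : VSet n) → X ⊆ᵛ Y → tabulate X ⊆ tabulate Y
tabulate-⊆ X Y X⊆Y x∈X = ∈-tabulate⁺ Y (X⊆Y _ (∈-tabulate⁻ X x∈X))

size-mono : (X Y : VSet n) → X ⊆ᵛ Y → size X ≤ size Y
size-mono X Y X⊆Y = p⊆q⇒∣p∣≤∣q∣ (tabulate-⊆ X Y X⊆Y)

size-strict : (X Y : VSet n) → X ⊆ᵛ Y → ∀ x → Y x ≡ true → X x ≡ false → size X < size Y
size-strict X Y X⊆Y x Yx Xx = p⊂q⇒∣p∣<∣q∣ (tabulate-⊆ X Y X⊆Y , x , ∈-tabulate⁺ Y Yx , ∉-tabulate⁺ X Xx)

size≤n : (X : VSet n) → size X ≤ n
size≤n X = ∣p∣≤n (tabulate X)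

size<n : (X : VSet n) → ∀ x → X x ≡ false → size X < n
size<n {n} X x Xx = subst (size X <_) (∣⊤∣≡n n) (p⊂q⇒∣p∣<∣q∣ ((λ _ → ∈⊤) , x , ∈⊤ , ∉-tabulate⁺ X Xx))

size>0 : (X : VSet n) → ∀ x → X x ≡ true → 0 < size X
size>0 {n} X x Xx = subst (_< size X) (∣⊥∣≡0 n) (p⊂q⇒∣p∣<∣q∣ ((⊥-elim ∘ ∉⊥) , x , ∈-tabulate⁺ X Xx , ∉⊥))

xorSum-cong : ∀ {m} {f g : Fin m → Bool} → f ≗ g → xorSum f ≡ xorSum g
xorSum-cong {zero}  f≗g = refl
xorSum-cong {suc m} f≗g = cong₂ _xor_ (f≗g zero) (xorSum-cong (f≗g ∘ suc))

xorSum≡true⇒∃ : ∀ {m} (f : Fin m → Bool) → xorSum f ≡ true → ∃ λ i → f i ≡ true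
xorSum≡true⇒∃ {zero}  f ()
xorSum≡true⇒∃ {suc m} f odd with f zero in f0
... | true  = zero , f0
... | false = let i , fi = xorSum≡true⇒∃ (f ∘ suc) odd in suc i , fi

module _ (G : Graph n) where

  CutRkAtMost-resp-≗ : ∀ {X Y k} → X ≗ Y → CutRkAtMost G X k → CutRkAtMost G Y k
  CutRkAtMost-resp-≗ X≗Y X≤k r r⊆Y independent = X≤k r (λ i → trans (X≗Y (r i)) (r⊆Y i)) λ c c≢0 →
    let y , Yy , odd = independent c c≢0 in y , trans (X≗Y y) Yy , odd

  -- Combine with the i-th unit vector.
  independent⇒cutEdge : ∀ {X m} {r : Fin m → Fin n} → RowsIndependent G X r →
                        ∀ i → ∃ λ y → X y ≡ false × adj G (r i) y ≡ true
  independent⇒cutEdge {r = r} independent i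
    with y , Xy , odd ← independent (λ j → does (i Fin.≟ j)) (i , dec-true (i Fin.≟ i) refl)
    with j , i≡j∧ri~y ← xorSum≡true⇒∃ (λ j → does (i Fin.≟ j) ∧ adj G (r j) y) odd
    with refl ← dec-true⁻¹ (i Fin.≟ j) (Boolₚ.∧-conicalˡ _ _ i≡j∧ri~y)
    = y , Xy , Boolₚ.∧-conicalʳ _ _ i≡j∧ri~y

  cutRk≤1-subsingleton : ∀ {X} → Subsingleton X → CutRkAtMost G X 1
  cutRk≤1-subsingleton X≤1 r r⊆X independent
    with y , _ , odd ← independent (λ _ → true) (zero , refl)
    = true≢false (trans (sym odd) (xor-cancel (cong (λ w → adj G w y) r₀≡r₁)))
    where
    r₀≡r₁ : r zero ≡ r (suc zero)
    r₀≡r₁ = X≤1 (r zero) (r (suc zero)) (r⊆X zero) (r⊆X (suc zero))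

  cutRk≤1-cosubsingleton : ∀ {X} → Subsingleton (not ∘ X) → CutRkAtMost G X 1
  cutRk≤1-cosubsingleton {X} X̅≤1 r r⊆X independent
    with y₀ , Xy₀ , r₀~y₀ ← independent⇒cutEdge {r = r} independent zero
    with y₁ , Xy₁ , r₁~y₁ ← independent⇒cutEdge {r = r} independent (suc zero)
    with y , Xy , odd ← independent (λ _ → true) (zero , refl)
    with refl ← X̅≤1 y₀ y (cong not Xy₀) (cong not Xy)
    with refl ← X̅≤1 y₁ y (cong not Xy₁) (cong not Xy)
    = true≢false (trans (sym odd) (cong₂ (λ a b → a xor (b xor false)) r₀~y₀ r₁~y₁))

  IsUnionOfComponents : VSet n → Set
  IsUnionOfComponents P = ∀ x y → adj G x y ≡ true → P x ≡ P y

-- A left inverse of punchIn z away from z; the value at z itself is junk.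
lower : ∀ {k} → Fin (suc (suc k)) → Fin (suc (suc k)) → Fin (suc k)
lower z v with z Fin.≟ v
... | yes _   = zero
... | no z≢v  = punchOut z≢v

punchIn-lower : ∀ {k} {z v : Fin (suc (suc k))} → z ≢ v → punchIn z (lower z v) ≡ v
punchIn-lower {z = z} {v} z≢v with z Fin.≟ v
... | yes z≡v = ⊥-elim (z≢v z≡v)
... | no z≢v′ = punchIn-punchOut z≢v′

lower-injective : ∀ {k} {z x y : Fin (suc (suc k))} → z ≢ x → z ≢ y → lower z x ≡ lower z y → x ≡ y
lower-injective z≢x z≢y eq = trans (sym (punchIn-lower z≢x)) (trans (cong (punchIn _) eq) (punchIn-lower z≢y))

-- If all edges crossing the cut of X lie in a union P of components not
-- containing z, then away from zero rows and columns the cut matrix of X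
-- in G is the cut matrix of X′ in G − z.
CutRkAtMost-lift-delete :
  ∀ {k w} (G : Graph (suc (suc k))) (P X : VSet (suc (suc k))) (X′ : VSet (suc k)) (z : Fin (suc (suc k))) →
  IsUnionOfComponents G P → P z ≡ false →
  (∀ x → P x ≡ true → X x ≡ X′ (lower z x)) →
  (∀ x y → X x ≡ true → X y ≡ false → adj G x y ≡ true → P x ≡ true) →
  CutRkAtMost (delete G z) X′ w → CutRkAtMost G X w
CutRkAtMost-lift-delete G P X X′ z P-union Pz agree crossing X′≤w r r⊆X independent =
  X′≤w (lower z ∘ r) (λ i → trans (sym (agree (r i) (Pr i))) (r⊆X i)) independent′
  where
  Pr : ∀ i → P (r i) ≡ true
  Pr i = let y , Xy , ri~y = independent⇒cutEdge G {r = r} independent i in crossing (r i) y (r⊆X i) Xy ri~y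

  z≢ : ∀ {v} → P v ≡ true → z ≢ v
  z≢ Pv refl = true≢false (trans (sym Pv) Pz)

  independent′ : RowsIndependent (delete G z) X′ (lower z ∘ r)
  independent′ c c≢0
    with y , Xy , odd ← independent c c≢0
    with j , cj∧rj~y ← xorSum≡true⇒∃ (λ i → c i ∧ adj G (r i) y) odd
    = lower z y , trans (sym (agree y Py)) Xy , trans (xorSum-cong same-entries) odd
    where
    Py : P y ≡ true
    Py = trans (sym (P-union (r j) y (Boolₚ.∧-conicalʳ _ _ cj∧rj~y))) (Pr j)

    same-entries : (λ i → c i ∧ adj G (punchIn z (lower z (r i))) (punchIn z (lower z y)))
                 ≗ (λ i → c i ∧ adj G (r i) y)
    same-entries i = cong (c i ∧_) (cong₂ (adj G) (punchIn-lower (z≢ (Pr i))) (punchIn-lower (z≢ Py)))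

record Layout (G : Graph n) : Set where
  field
    key           : Fin n → ℕ
    key-injective : Injective _≡_ _≡_ key
    below-cutRk≤1 : ∀ t → CutRkAtMost G (below key t) 1

injective⇒surjective : {f : Fin n → Fin n} → Injective _≡_ _≡_ f → ∀ i → ∃ λ v → f v ≡ i
injective⇒surjective {suc n} {f} f-injective i with any? (λ v → f v Fin.≟ i)
... | yes hit = hit
... | no miss = ⊥-elim (1+n≰n (injective⇒≤ f′-injective))
  where
  i≢f : ∀ v → i ≢ f v
  i≢f v i≡fv = miss (v , sym i≡fv)

  f′ : Fin (suc n) → Fin n
  f′ v = punchOut (i≢f v)

  f′-injective : Injective _≡_ _≡_ f′
  f′-injective = f-injective ∘ punchOut-injective (i≢f _) (i≢f _)

-- The permutation π with π ⟨$⟩ˡ_ = f definitionally.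
permutationOf : (f : Fin n → Fin n) → Injective _≡_ _≡_ f → Permutation′ n
permutationOf f f-injective =
  permutation (proj₁ ∘ surjective) f (λ v → f-injective (proj₂ (surjective (f v)))) (proj₂ ∘ surjective)
  where
  surjective : ∀ i → ∃ λ v → f v ≡ i
  surjective = injective⇒surjective f-injective

module Ranking {n} (K : Fin n → ℕ) (K-injective : Injective _≡_ _≡_ K) where

  rank : Fin n → ℕ
  rank v = size (below K (K v))

  rank<n : ∀ v → rank v < n
  rank<n v = size<n (below K (K v)) v (dec-false (K v <? K v) (<-irrefl refl))

  below-mono : ∀ {s t} → s ≤ t → below K s ⊆ᵛ below K t
  below-mono s≤t x x<s = dec-true (_ <? _) (<-≤-trans (dec-true⁻¹ (_ <? _) x<s) s≤t)

  rank-mono-≤ : ∀ {v w} → K v ≤ K w → rank v ≤ rank w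
  rank-mono-≤ Kv≤Kw = size-mono _ _ (below-mono Kv≤Kw)

  rank-mono-< : ∀ {v w} → K v < K w → rank v < rank w
  rank-mono-< {v} {w} Kv<Kw =
    size-strict _ _ (below-mono (<⇒≤ Kv<Kw)) v (dec-true (K v <? K w) Kv<Kw)
      (dec-false (K v <? K v) (<-irrefl refl))

  rank-cancel-< : ∀ {v w} → rank v < rank w → K v < K w
  rank-cancel-< {v} {w} rv<rw with K v <? K w
  ... | yes Kv<Kw = Kv<Kw
  ... | no Kv≮Kw  = ⊥-elim (<-irrefl refl (<-≤-trans rv<rw (rank-mono-≤ (≮⇒≥ Kv≮Kw))))

  rankᶠ : Fin n → Fin n
  rankᶠ v = fromℕ< (rank<n v)

  toℕ-rankᶠ : ∀ v → toℕ (rankᶠ v) ≡ rank v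
  toℕ-rankᶠ v = toℕ-fromℕ< (rank<n v)

  rank-injective : Injective _≡_ _≡_ rank
  rank-injective {v} {w} rv≡rw with <-cmp (K v) (K w)
  ... | tri< Kv<Kw _ _ = ⊥-elim (<-irrefl rv≡rw (rank-mono-< Kv<Kw))
  ... | tri≈ _ Kv≡Kw _ = K-injective Kv≡Kw
  ... | tri> _ _ Kw<Kv = ⊥-elim (<-irrefl (sym rv≡rw) (rank-mono-< Kw<Kv))

  rankᶠ-injective : Injective _≡_ _≡_ rankᶠ
  rankᶠ-injective {v} {w} eq =
    rank-injective (trans (sym (toℕ-rankᶠ v)) (trans (cong toℕ eq) (toℕ-rankᶠ w)))

Layout⇒LRW≤1 : {G : Graph n} → 2 ≤ n → Layout G → LRW≤1 G
Layout⇒LRW≤1 {n} {G} 2≤n L = inj₂ (2≤n , π , singletons , prefixes)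
  where
  open Layout L
  open Ranking key key-injective

  π : Permutation′ n
  π = permutationOf rankᶠ rankᶠ-injective

  singletons : ∀ ℓ → CutRkAtMost G (singletonSet (π ⟨$⟩ʳ ℓ)) 1
  singletons ℓ = cutRk≤1-subsingleton G λ x y ℓ≡x ℓ≡y →
    trans (sym (dec-true⁻¹ ((π ⟨$⟩ʳ ℓ) Fin.≟ x) ℓ≡x)) (dec-true⁻¹ ((π ⟨$⟩ʳ ℓ) Fin.≟ y) ℓ≡y)

  -- The prefix of length j + 2 is the set of vertices below the one of rank j + 2.
  prefixes : ∀ j → j + 4 ≤ n → CutRkAtMost G (prefixSet π j) 1
  prefixes j j+4≤n = CutRkAtMost-resp-≗ G below≗prefix (below-cutRk≤1 (key w))
    where
    2+j<n : suc (suc j) < n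
    2+j<n = ≤-trans (n≤1+n _) (subst (_≤ n) (+-comm j 4) j+4≤n)

    w : Fin n
    w = π ⟨$⟩ʳ fromℕ< 2+j<n

    rank-w : rank w ≡ suc (suc j)
    rank-w = trans (sym (toℕ-rankᶠ w)) (trans (cong toℕ (inverseˡ π)) (toℕ-fromℕ< 2+j<n))

    below≗prefix : below key (key w) ≗ prefixSet π j
    below≗prefix v = does-⇔ (mk⇔ to from) (key v <? key w) (toℕ (rankᶠ v) ≤? suc j)
      where
      to : key v < key w → toℕ (rankᶠ v) ≤ suc j
      to kv<kw = subst (_≤ suc j) (sym (toℕ-rankᶠ v)) (s≤s⁻¹ (subst (rank v <_) rank-w (rank-mono-< kv<kw)))

      from : toℕ (rankᶠ v) ≤ suc j → key v < key w
      from rv≤1+j = rank-cancel-< (subst (rank v <_) (sym rank-w) (s≤s (subst (_≤ suc j) (toℕ-rankᶠ v) rv≤1+j)))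

LRW≤1⇒Layout : {H : Graph n} → LRW≤1 H → Σ (Layout H) λ L → ∀ x → Layout.key L x < n
LRW≤1⇒Layout {n} {H} (inj₁ n≤1) = L , λ x → ≤-trans (s≤s z≤n) (toℕ<n x)
  where
  L : Layout H
  L = record
    { key           = λ _ → 0
    ; key-injective = λ {x} {y} _ → Subsingleton-≤1 n≤1 (λ _ → true) x y refl refl
    ; below-cutRk≤1 = λ t → cutRk≤1-subsingleton H (Subsingleton-≤1 n≤1 _)
    }
LRW≤1⇒Layout {n} {H} (inj₂ (_ , π , _ , prefix-cuts)) = L , λ x → toℕ<n (π ⟨$⟩ˡ x)
  where
  key : Fin n → ℕ
  key x = toℕ (π ⟨$⟩ˡ x)

  key-injective : Injective _≡_ _≡_ key
  key-injective eq = trans (sym (inverseʳ π)) (trans (cong (π ⟨$⟩ʳ_) (toℕ-injective eq)) (inverseʳ π))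

  short : ∀ t → t ≤ 1 → CutRkAtMost H (below key t) 1
  short t t≤1 = cutRk≤1-subsingleton H λ x y x<t y<t → key-injective (trans (key≡0 x x<t) (sym (key≡0 y y<t)))
    where
    key≡0 : ∀ x → below key t x ≡ true → key x ≡ 0
    key≡0 x x<t = n<1⇒n≡0 (<-≤-trans (dec-true⁻¹ (key x <? t) x<t) t≤1)

  long : ∀ j → CutRkAtMost H (below key (suc (suc j))) 1
  long j with n ≤? 3 + j
  ... | yes n≤3+j = cutRk≤1-cosubsingleton H λ x y x≮ y≮ → key-injective (trans (key≡2+j x x≮) (sym (key≡2+j y y≮)))
    where
    key≡2+j : ∀ x → not (below key (suc (suc j)) x) ≡ true → key x ≡ suc (suc j)
    key≡2+j x x≮ = ≤-antisym (s≤s⁻¹ (≤-trans (toℕ<n (π ⟨$⟩ˡ x)) n≤3+j))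
                             (≮⇒≥ (dec-false⁻¹ (key x <? suc (suc j)) (Boolₚ.not-injective x≮)))
  ... | no n≰3+j = CutRkAtMost-resp-≗ H (λ x → does-⇔ (mk⇔ s≤s s≤s⁻¹) (key x ≤? suc j) (key x <? suc (suc j)))
                     (prefix-cuts j (subst (_≤ n) (+-comm 4 j) (≰⇒> n≰3+j)))

  L : Layout H
  L = record
    { key           = key
    ; key-injective = key-injective
    ; below-cutRk≤1 = λ { zero → short 0 z≤n ; (suc zero) → short 1 ≤-refl ; (suc (suc j)) → long j }
    }

module Glue {k} (G : Graph (suc (suc k))) (S : VSet (suc (suc k))) (S-union : IsUnionOfComponents G S)
            {a b : Fin (suc (suc k))} (Sa : S a ≡ true) (Sb : S b ≡ false)
            (LA : Layout (delete G a)) (LB : Layout (delete G b)) (LB-bounded : ∀ x → Layout.key LB x < suc k)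
            where

  private
    N : ℕ
    N = suc (suc k)
    module A = Layout LA
    module B = Layout LB

  K : Fin N → ℕ
  K v = if S v then B.key (lower b v) else N + A.key (lower a v)

  K-in : ∀ {v} → S v ≡ true → K v ≡ B.key (lower b v)
  K-in {v} Sv = cong (λ s → if s then B.key (lower b v) else N + A.key (lower a v)) Sv

  K-out : ∀ {v} → S v ≡ false → K v ≡ N + A.key (lower a v)
  K-out {v} Sv = cong (λ s → if s then B.key (lower b v) else N + A.key (lower a v)) Sv

  K-in<N : ∀ {v} → S v ≡ true → K v < N
  K-in<N Sv = subst (_< N) (sym (K-in Sv)) (≤-trans (LB-bounded _) (n≤1+n _))

  N≤K-out : ∀ {v} → S v ≡ false → N ≤ K v
  N≤K-out Sv = subst (N ≤_) (sym (K-out Sv)) (m≤m+n N _)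

  b≢ : ∀ {v} → S v ≡ true → b ≢ v
  b≢ Sv refl = true≢false (trans (sym Sv) Sb)

  a≢ : ∀ {v} → S v ≡ false → a ≢ v
  a≢ Sv refl = true≢false (trans (sym Sa) Sv)

  K-injective : Injective _≡_ _≡_ K
  K-injective {x} {y} Kx≡Ky = by-sides (S x) (S y) refl refl
    where
    by-sides : ∀ s t → S x ≡ s → S y ≡ t → x ≡ y
    by-sides true true Sx Sy =
      lower-injective (b≢ Sx) (b≢ Sy) (B.key-injective (trans (sym (K-in Sx)) (trans Kx≡Ky (K-in Sy))))
    by-sides false false Sx Sy =
      lower-injective (a≢ Sx) (a≢ Sy)
        (A.key-injective (+-cancelˡ-≡ N _ _ (trans (sym (K-out Sx)) (trans Kx≡Ky (K-out Sy)))))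
    by-sides true false Sx Sy = ⊥-elim (<-irrefl Kx≡Ky (<-≤-trans (K-in<N Sx) (N≤K-out Sy)))
    by-sides false true Sx Sy = ⊥-elim (<-irrefl (sym Kx≡Ky) (<-≤-trans (K-in<N Sy) (N≤K-out Sx)))

  below-inside : ∀ {t} → t ≤ N → below K t ⊆ᵛ S
  below-inside {t} t≤N x x<t with S x Boolₚ.≟ true
  ... | yes Sx = Sx
  ... | no ¬Sx = ⊥-elim (<-irrefl refl
                   (<-≤-trans (≤-<-trans (N≤K-out (Boolₚ.¬-not ¬Sx)) (dec-true⁻¹ (K x <? t) x<t)) t≤N))

  S-below : ∀ {t} → N < t → S ⊆ᵛ below K t
  S-below {t} N<t x Sx = dec-true (K x <? t) (<-trans (K-in<N Sx) N<t)

  below-cutRk≤1 : ∀ t → CutRkAtMost G (below K t) 1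
  below-cutRk≤1 t with t ≤? N
  ... | yes t≤N =
    CutRkAtMost-lift-delete G S (below K t) (below B.key t) b S-union Sb
      (λ x Sx → cong (λ m → does (m <? t)) (K-in Sx))
      (λ x _ x<t _ _ → below-inside t≤N x x<t)
      (B.below-cutRk≤1 t)
  ... | no t≰N =
    CutRkAtMost-lift-delete G (not ∘ S) (below K t) (below A.key (t ∸ N)) a
      (λ x y x~y → cong not (S-union x y x~y)) (cong not Sa)
      (λ x S̅x → trans (cong (λ m → does (m <? t)) (K-out {x} (Boolₚ.not-injective S̅x))) (+-<?-∸ N _ t))
      crossing
      (A.below-cutRk≤1 (t ∸ N))
    where
    outside : ∀ y → below K t y ≡ false → S y ≡ false
    outside y y≮t with S y Boolₚ.≟ true
    ... | yes Sy = ⊥-elim (true≢false (trans (sym (S-below (≰⇒> t≰N) y Sy)) y≮t))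
    ... | no ¬Sy = Boolₚ.¬-not ¬Sy

    crossing : ∀ x y → below K t x ≡ true → below K t y ≡ false → adj G x y ≡ true → not (S x) ≡ true
    crossing x y _ y≮t x~y = cong not (trans (S-union x y x~y) (outside y y≮t))

  layout : Layout G
  layout = record { key = K ; key-injective = K-injective ; below-cutRk≤1 = below-cutRk≤1 }

separated⇒LRW≤1 : (G : Graph n) (S : VSet n) → IsUnionOfComponents G S →
                  ∀ {a b} → S a ≡ true → S b ≡ false →
                  LRW≤1 (delete G a) → LRW≤1 (delete G b) → LRW≤1 G
separated⇒LRW≤1 {suc zero} G S _ {zero} {zero} Sa Sb _ _ = ⊥-elim (true≢false (trans (sym Sa) Sb))
separated⇒LRW≤1 {suc (suc k)} G S S-union Sa Sb G−a G−b
  with LA , _ ← LRW≤1⇒Layout G−a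
  with LB , LB-bounded ← LRW≤1⇒Layout G−b
  = Layout⇒LRW≤1 (s≤s (s≤s z≤n)) (Glue.layout G S S-union Sa Sb LA LB LB-bounded)

reachable-snoc : {G : Graph n} {u x y : Fin n} → Reachable G u x → adj G x y ≡ true → Reachable G u y
reachable-snoc here         x~y = step x~y here
reachable-snoc (step u~w p) x~y = step u~w (reachable-snoc p x~y)

module Component (G : Graph n) (u : Fin n) where

  Closed : VSet n → Set
  Closed X = ∀ x y → X x ≡ true → adj G x y ≡ true → X y ≡ true

  adjacent? : (X : VSet n) (y : Fin n) → Dec (∃ λ x → X x ≡ true × adj G x y ≡ true)
  adjacent? X y = any? λ x → (X x Boolₚ.≟ true) ×-dec (adj G x y Boolₚ.≟ true)

  ball : ℕ → VSet n
  ball zero    y = does (u Fin.≟ y)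
  ball (suc k) y = ball k y ∨ does (adjacent? (ball k) y)

  ball-suc⁻ : ∀ k y → ball (suc k) y ≡ true → ball k y ≡ true ⊎ ∃ λ x → ball k x ≡ true × adj G x y ≡ true
  ball-suc⁻ k y y∈ with ball k y Boolₚ.≟ true
  ... | yes y∈ₖ = inj₁ y∈ₖ
  ... | no y∉ₖ  = inj₂ (dec-true⁻¹ (adjacent? (ball k) y)
                         (subst (λ b → b ∨ does (adjacent? (ball k) y) ≡ true) (Boolₚ.¬-not y∉ₖ) y∈))

  ball-⊆-suc : ∀ k → ball k ⊆ᵛ ball (suc k)
  ball-⊆-suc k y y∈ = cong (_∨ does (adjacent? (ball k) y)) y∈

  ball-step : ∀ k x y → ball k x ≡ true → adj G x y ≡ true → ball (suc k) y ≡ true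
  ball-step k x y x∈ x~y =
    trans (cong (ball k y ∨_) (dec-true (adjacent? (ball k) y) (x , x∈ , x~y))) (Boolₚ.∨-zeroʳ _)

  ball-sound : ∀ k y → ball k y ≡ true → Reachable G u y
  ball-sound zero y u≡y with refl ← dec-true⁻¹ (u Fin.≟ y) u≡y = here
  ball-sound (suc k) y y∈ with ball-suc⁻ k y y∈
  ... | inj₁ y∈ₖ             = ball-sound k y y∈ₖ
  ... | inj₂ (x , x∈ₖ , x~y) = reachable-snoc (ball-sound k x x∈ₖ) x~y

  ball-closed⇒stable : ∀ {k} → Closed (ball k) → ball (suc k) ⊆ᵛ ball k
  ball-closed⇒stable {k} closed y y∈ with ball-suc⁻ k y y∈
  ... | inj₁ y∈ₖ             = y∈ₖ
  ... | inj₂ (x , x∈ₖ , x~y) = closed x y x∈ₖ x~y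

  ball-closed-or-grows : ∀ k → Closed (ball k) ⊎ suc k ≤ size (ball k)
  ball-closed-or-grows zero = inj₂ (size>0 (ball zero) u (dec-true (u Fin.≟ u) refl))
  ball-closed-or-grows (suc k) with any? (λ y → (ball (suc k) y Boolₚ.≟ true) ×-dec (ball k y Boolₚ.≟ false))
  ... | no nothing-new = inj₁ λ x y x∈ x~y → ball-step k x y (old x x∈) x~y
    where
    old : ball (suc k) ⊆ᵛ ball k
    old x x∈ with ball k x Boolₚ.≟ true
    ... | yes x∈ₖ = x∈ₖ
    ... | no x∉ₖ  = ⊥-elim (nothing-new (x , x∈ , Boolₚ.¬-not x∉ₖ))
  ... | yes (y , y∈ , y∉ₖ) with ball-closed-or-grows k
  ...   | inj₁ closed = ⊥-elim (true≢false (trans (sym (ball-closed⇒stable {k} closed y y∈)) y∉ₖ))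
  ...   | inj₂ grown  = inj₂ (≤-trans (s≤s grown) (size-strict (ball k) (ball (suc k)) (ball-⊆-suc k) y y∈ y∉ₖ))

  component : VSet n
  component = ball n

  component-sound : ∀ y → component y ≡ true → Reachable G u y
  component-sound = ball-sound n

  u∈component : component u ≡ true
  u∈component = u∈ball n
    where
    u∈ball : ∀ k → ball k u ≡ true
    u∈ball zero    = dec-true (u Fin.≟ u) refl
    u∈ball (suc k) = ball-⊆-suc k u (u∈ball k)

  component-closed : Closed component
  component-closed with ball-closed-or-grows n
  ... | inj₁ closed = closed
  ... | inj₂ grown  = ⊥-elim (1+n≰n (≤-trans grown (size≤n component)))

  component-union : IsUnionOfComponents G component
  component-union x y x~y with component x in x∈ | component y in y∈
  ... | true  | true  = refl
  ... | false | false = refl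
  ... | true  | false = ⊥-elim (true≢false (trans (sym (component-closed x y x∈ x~y)) y∈))
  ... | false | true  = ⊥-elim (true≢false (trans (sym (component-closed y x y∈ (trans (adj-sym G y x) x~y))) x∈))

lemma15 : ∀ {n} (G : Graph n) → Obstruction LRW≤1 G → Connected G
lemma15 {zero}  G obstruction = ⊥-elim (proj₁ (obstruction G here) (inj₁ z≤n))
lemma15 {suc n} G obstruction = s≤s z≤n , connected
  where
  G∉𝒞 : ¬ LRW≤1 G
  G∉𝒞 = proj₁ (obstruction G here)

  G−v∈𝒞 : ∀ v → LRW≤1 (delete G v)
  G−v∈𝒞 = proj₂ (obstruction G here)

  connected : ∀ u v → Reachable G u v
  connected u v with Component.component G u v in v∈
  ... | true  = Component.component-sound G u v v∈
  ... | false = ⊥-elim (G∉𝒞 (separated⇒LRW≤1 G (Component.component G u) (Component.component-union G u)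
                                (Component.u∈component G u) v∈ (G−v∈𝒞 u) (G−v∈𝒞 v)))
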